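{- Let $D\in\mathcal{S}_n^k$ and let $h:E(D)\to\mathcal{T}^q_\sigma$ be any function, where every $F\in\mathcal{T}^q_\sigma$ has $p$ vertices. Let $\widetilde h$ be the labeling of $D\otimes_h\mathcal{T}^q_\sigma$ defined by $\widetilde h(i,a)=(p+q)(i-1)+a$ on vertices and $\widetilde h((i,a),(j,b))=(p+q)(k+n-(i+j)-1)+(\sigma-(a+b))$ on arcs. Then $\widetilde h$ is an edge-magic labeling with valence $\mathrm{val}(\widetilde h)=(p+q)(k+n-3)+\sigma$.
   Context: Digraphs may have loops but no multiple arcs. $[a,b]=\{a,\dots,b\}$. An edge-magic labeling of a $(p,q)$-(di)graph $G$ is a bijection $f:V(G)\cup E(G)\to[1,p+q]$ with $f(x)+f(xy)+f(y)=\mathrm{val}(f)$ constant over edges (the valence/magic sum); super if $f(V(G))=[1,p]$. $\mathcal{S}_n^k$: the set of digraphs $D$ with vertex set $[1,n]$ (vertices named by their super edge-magic labels), exactly $n$ arcs, and $\{i+j:(i,j)\in E(D)\}=[k,k+n-1]$. Fix a set $V$ of $p$ positive integers. $\mathcal{T}^q_\sigma$ is a family of edge-magic labeled digraphs $F$, each with vertex set $V(F)=V$ (each vertex named by its label), $|E(F)|=q$, and magic sum $\sigma$. For $h:E(D)\to\mathcal{T}^q_\sigma$, $D\otimes_h\mathcal{T}^q_\sigma$ has vertex set $V(D)\times V$, with arc $((i,a),(j,b))$ iff $(i,j)\in E(D)$ and $(a,b)\in E(h(i,j))$. -}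

module Defs where

open import Data.Nat using (ℕ; _+_; _*_; _∸_; _≤_; _<_)
open import Data.Product using (_×_; _,_; proj₁; proj₂; Σ)
open import Data.List using (List; map; length; _++_; applyUpTo; concatMap)
open import Data.List.Relation.Unary.All using (All)
open import Data.List.Relation.Unary.Unique.Propositional using (Unique)
open import Data.List.Membership.Propositional using (_∈_)
open import Data.List.Relation.Binary.Permutation.Propositional using (_↭_)
open import Function.Bundles using (_⇔_)

segment : ℕ → ℕ → List ℕ
segment a len = applyUpTo (a +_) len

[1,_] : ℕ → List ℕ
[1, N ] = segment 1 N

-- A (finite) digraph is given by a duplicate-free list of vertices and a
-- duplicate-free list of arcs (ordered pairs; loops allowed, no multiple arcs)
-- whose endpoints are vertices.
IsDigraph : {A : Set} → List A → List (A × A) → Set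
IsDigraph Vs Es = Unique Vs × Unique Es × All (λ e → proj₁ e ∈ Vs × proj₂ e ∈ Vs) Es

-- An edge-magic labeling of the (p,q)-digraph (Vs, Es), given by a vertex part f
-- and an arc part g, with valence val:
--   * f ∪ g is a bijection V ∪ E → [1, p+q]  (the list of all labels is a
--     permutation of [1, p+q]; Vs, Es are duplicate-free so this is a bijection)
--   * f(x) + g(xy) + f(y) = val for every arc xy.
IsEdgeMagic : {A : Set} → (Vs : List A) → (Es : List (A × A)) →
              (f : A → ℕ) → (g : A × A → ℕ) → (val : ℕ) → Set
IsEdgeMagic Vs Es f g val =
  Unique Vs × Unique Es ×
  ((map f Vs ++ map g Es) ↭ [1, length Vs + length Es ]) ×
  All (λ e → f (proj₁ e) + g e + f (proj₂ e) ≡' val) Es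
  where
  open import Relation.Binary.PropositionalEquality renaming (_≡_ to _≡'_)

InS : (n k : ℕ) → List (ℕ × ℕ) → Set
InS n k As =
  IsDigraph [1, n ] As × length As ≡' n ×
  ((m : ℕ) → (m ∈ map (λ e → proj₁ e + proj₂ e) As) ⇔ (m ∈ segment k n))
  where
  open import Relation.Binary.PropositionalEquality renaming (_≡_ to _≡'_)

-- F ∈ T^q_σ (with fixed vertex set Vs): F is a digraph with vertex set Vs
-- (vertices named by their labels), exactly q arcs, admitting an edge-magic
-- labeling whose vertex part is the identity, with magic sum σ.
InT : (Vs : List ℕ) (q σ : ℕ) → List (ℕ × ℕ) → Set
InT Vs q σ Es =
  IsDigraph Vs Es × length Es ≡' q ×
  Σ (ℕ × ℕ → ℕ) (λ g → IsEdgeMagic Vs Es (λ a → a) g σ)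
  where
  open import Relation.Binary.PropositionalEquality renaming (_≡_ to _≡'_)

prodVertices : (n : ℕ) → List ℕ → List (ℕ × ℕ)
prodVertices n Vs = concatMap (λ i → map (λ a → (i , a)) Vs) [1, n ]

prodArcs : List (ℕ × ℕ) → (ℕ × ℕ → List (ℕ × ℕ)) → List ((ℕ × ℕ) × (ℕ × ℕ))
prodArcs As h =
  concatMap (λ e → map (λ ab → ((proj₁ e , proj₁ ab) , (proj₂ e , proj₂ ab))) (h e)) As

htildeV : (p q : ℕ) → ℕ × ℕ → ℕ
htildeV p q (i , a) = (p + q) * (i ∸ 1) + a

htildeA : (p q n k σ : ℕ) → (ℕ × ℕ) × (ℕ × ℕ) → ℕ
htildeA p q n k σ ((i , a) , (j , b)) = (p + q) * (k + n ∸ (i + j) ∸ 1) + (σ ∸ (a + b))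

module Submission where

-- h̃ cuts [1, n(p + q)] into n layers of width p + q. The vertex (i, a) sits at offset a in layer
-- i − 1; an arc over (i, j) of D with endpoint sum k + u sits in layer n − 1 − u, at offset
-- σ − (a + b), which is the label of (a, b) in h(i, j). Along an arc the layers add up to
-- (i − 1) + (j − 1) + (k + n − 1 − (i + j)) = k + n − 3 and the offsets to σ, giving the valence.
-- Bijectivity is counting: there are exactly n(p + q) labels, and each layer t is covered, because
-- some arc of D has endpoint sum k + n − 1 − t and the labels of its digraph fill [1, p + q].

open import Defs
open import Data.Nat using (ℕ; zero; suc; _+_; _*_; _∸_; _<_; _≤_; z<s; s≤s⁻¹)
open import Data.Nat.Properties
open import Data.Nat.DivMod using (_/_; _%_; m≡m%n+[m/n]*n; m%n<n; m<n*o⇒m/o<n)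
open import Data.Nat.Tactic.RingSolver using (solve-∀)
open import Data.Product using (_×_; _,_; proj₁; proj₂; ∃₂; map₁)
open import Data.Sum using (inj₁; inj₂)
open import Data.Empty using (⊥-elim)
open import Data.List using (List; []; _∷_; length; map; _++_; concatMap)
open import Data.List.Properties using (length-map; length-++; length-applyUpTo)
open import Data.List.Relation.Unary.All as All using (All)
import Data.List.Relation.Unary.All.Properties as All
open import Data.List.Relation.Unary.Any using (here; there)
open import Data.List.Relation.Unary.AllPairs using ([]; _∷_)
open import Data.List.Relation.Unary.Unique.Propositional using (Unique)
import Data.List.Relation.Unary.Unique.Propositional.Properties as Unique
open import Data.List.Membership.Propositional using (_∈_; lose; find)
open import Data.List.Membership.Propositional.Properties
open import Data.List.Relation.Binary.Subset.Propositional using (_⊆_)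
open import Data.List.Relation.Binary.Permutation.Propositional using (_↭_; ↭-sym; ↭-trans; ↭-refl; prep; ↭⇒↭ₛ)
open import Data.List.Relation.Binary.Permutation.Propositional.Properties using (shift; ∈-resp-↭; ↭-length)
import Data.List.Relation.Binary.Permutation.Setoid.Properties as Permutationₛ
open import Relation.Binary.PropositionalEquality
open import Function using (_∘_; case_of_)
open import Function.Bundles using (_⇔_; Equivalence)

module _ {a} {A : Set a} where

  Unique-++⁻ : ∀ (xs : List A) {ys} → Unique (xs ++ ys) → Unique xs × Unique ys
  Unique-++⁻ []       u         = [] , u
  Unique-++⁻ (x ∷ xs) (x∉ ∷ u) = map₁ (All.++⁻ˡ xs x∉ ∷_) (Unique-++⁻ xs u)

  ⊆-length≤⇒↭ : ∀ {xs ys : List A} → Unique ys → ys ⊆ xs → length xs ≤ length ys → xs ↭ ys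
  ⊆-length≤⇒↭ {[]}    {[]}     _          _    _ = ↭-refl
  ⊆-length≤⇒↭ {_ ∷ _} {[]}     _          _    ()
  ⊆-length≤⇒↭ {xs}    {y ∷ ys} (y∉ ∷ uys) ys⊆ ≤len with ∈-∃++ (ys⊆ (here refl))
  ... | us , vs , refl =
    ↭-trans (shift y us vs) (prep y (⊆-length≤⇒↭ uys ys⊆us++vs (s≤s⁻¹ (subst (_≤ _) (↭-length (shift y us vs)) ≤len))))
    where
    ys⊆us++vs : ys ⊆ us ++ vs
    ys⊆us++vs z∈ys with ∈-resp-↭ (shift y us vs) (ys⊆ (there z∈ys))
    ... | here refl = ⊥-elim (All.lookup y∉ z∈ys refl)
    ... | there z∈  = z∈

length-concatMap-const : ∀ {a b} {A : Set a} {B : Set b} (f : A → List B) {c} (xs : List A) →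
  (∀ {x} → x ∈ xs → length (f x) ≡ c) → length (concatMap f xs) ≡ length xs * c
length-concatMap-const f []       _   = refl
length-concatMap-const f (x ∷ xs) len =
  trans (length-++ (f x)) (cong₂ _+_ (len (here refl)) (length-concatMap-const f xs (len ∘ there)))

Unique-[1,] : ∀ m → Unique [1, m ]
Unique-[1,] m = Unique.applyUpTo⁺₁ suc m (λ i<j _ → <⇒≢ i<j ∘ suc-injective)

<*⇒quotRem : ∀ i n d → i < n * d → ∃₂ λ t r → t < n × r < d × i ≡ d * t + r
<*⇒quotRem i n zero    i<0 = ⊥-elim (n≮0 (subst (i <_) (*-zeroʳ n) i<0))
<*⇒quotRem i n d@(suc _) i<nd =
  i / d , i % d , m<n*o⇒m/o<n i<nd , m%n<n i d ,
  trans (m≡m%n+[m/n]*n i d) (trans (+-comm (i % d) _) (cong (_+ i % d) (*-comm (i / d) d)))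

htildeA-layer : ∀ p q {n k σ i j a b u w c} → i + j ≡ k + u → u + suc w ≡ n → a + c + b ≡ σ →
  htildeA p q n k σ ((i , a) , (j , b)) ≡ (p + q) * w + c
htildeA-layer p q {k = k} {i = i} {j} {a} {b} {u} {w} {c} i+j≡k+u refl refl =
  cong₂ (λ x y → (p + q) * x + y) layer offset
  where
  open ≡-Reasoning
  layer : k + (u + suc w) ∸ (i + j) ∸ 1 ≡ w
  layer = begin
    k + (u + suc w) ∸ (i + j) ∸ 1 ≡⟨ cong (λ s → k + (u + suc w) ∸ s ∸ 1) i+j≡k+u ⟩
    k + (u + suc w) ∸ (k + u) ∸ 1 ≡⟨ cong (λ s → s ∸ (k + u) ∸ 1) (+-assoc k u (suc w)) ⟨
    k + u + suc w ∸ (k + u) ∸ 1   ≡⟨ cong (_∸ 1) (m+n∸m≡n (k + u) (suc w)) ⟩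
    w                             ∎
  offset : a + c + b ∸ (a + b) ≡ c
  offset = trans (cong (_∸ (a + b)) (+-right-comm a c b)) (m+n∸m≡n (a + b) c)
    where
    +-right-comm : ∀ x y z → x + y + z ≡ x + z + y
    +-right-comm = solve-∀

htilde-magic : ∀ p q {n k σ i j a b u w c} → suc i + suc j ≡ k + u → u + suc w ≡ n → a + c + b ≡ σ →
  htildeV p q (suc i , a) + htildeA p q n k σ ((suc i , a) , (suc j , b)) + htildeV p q (suc j , b)
    ≡ (p + q) * (k + n ∸ 3) + σ
htilde-magic p q {n} {k} {σ} {i} {j} {a} {b} {u} {w} {c} i+j≡k+u u+w≡n a+c+b≡σ = begin
  N * i + a + htildeA p q n k σ ((suc i , a) , (suc j , b)) + (N * j + b)
    ≡⟨ cong (λ x → N * i + a + x + (N * j + b)) (htildeA-layer p q {i = suc i} {suc j} {a} {b} i+j≡k+u u+w≡n a+c+b≡σ) ⟩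
  N * i + a + (N * w + c) + (N * j + b) ≡⟨ regroup N i j w a c b ⟩
  N * (i + j + w) + (a + c + b)          ≡⟨ cong₂ (λ x y → N * x + y) (sym k+n∸3≡i+j+w) a+c+b≡σ ⟩
  N * (k + n ∸ 3) + σ                    ∎
  where
  open ≡-Reasoning
  N : ℕ
  N = p + q
  regroup : ∀ N i j w a c b → N * i + a + (N * w + c) + (N * j + b) ≡ N * (i + j + w) + (a + c + b)
  regroup = solve-∀
  k+n≡3+i+j+w : k + n ≡ 3 + (i + j + w)
  k+n≡3+i+j+w = begin
    k + n               ≡⟨ cong (k +_) u+w≡n ⟨
    k + (u + suc w)     ≡⟨ +-assoc k u (suc w) ⟨
    k + u + suc w       ≡⟨ cong (_+ suc w) i+j≡k+u ⟨
    suc i + suc j + suc w ≡⟨ three-sucs i j w ⟩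
    3 + (i + j + w)     ∎
    where
    three-sucs : ∀ i j w → suc i + suc j + suc w ≡ 3 + (i + j + w)
    three-sucs = solve-∀
  k+n∸3≡i+j+w : k + n ∸ 3 ≡ i + j + w
  k+n∸3≡i+j+w = cong (_∸ 3) k+n≡3+i+j+w

module ProductLabeling (n k p q σ : ℕ) (Vs : List ℕ) (As : List (ℕ × ℕ)) (h : ℕ × ℕ → List (ℕ × ℕ))
  (|Vs|≡p : length Vs ≡ p) (D∈S : InS n k As) (h∈T : ∀ {e} → e ∈ As → InT Vs q σ (h e)) where

  N : ℕ
  N = p + q

  arcSum : ℕ × ℕ → ℕ
  arcSum e = proj₁ e + proj₂ e

  liftArc : ℕ × ℕ → ℕ × ℕ → (ℕ × ℕ) × (ℕ × ℕ)
  liftArc e ab = ((proj₁ e , proj₁ ab) , (proj₂ e , proj₂ ab))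

  V : List (ℕ × ℕ)
  V = prodVertices n Vs

  E : List ((ℕ × ℕ) × (ℕ × ℕ))
  E = prodArcs As h

  f : ℕ × ℕ → ℕ
  f = htildeV p q

  g : (ℕ × ℕ) × (ℕ × ℕ) → ℕ
  g = htildeA p q n k σ

  labels : List ℕ
  labels = map f V ++ map g E

  endpoints∈[1,n] : All (λ e → proj₁ e ∈ [1, n ] × proj₂ e ∈ [1, n ]) As
  endpoints∈[1,n] = proj₂ (proj₂ (proj₁ D∈S))

  |As|≡n : length As ≡ n
  |As|≡n = proj₁ (proj₂ D∈S)

  arcSums : (m : ℕ) → (m ∈ map arcSum As) ⇔ (m ∈ segment k n)
  arcSums = proj₂ (proj₂ D∈S)

  module OnArc {e} (e∈ : e ∈ As) where

    |h|≡q : length (h e) ≡ q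
    |h|≡q = proj₁ (proj₂ (h∈T e∈))

    label : ℕ × ℕ → ℕ
    label = proj₁ (proj₂ (proj₂ (h∈T e∈)))

    labels↭ : map (λ a → a) Vs ++ map label (h e) ↭ [1, length Vs + length (h e) ]
    labels↭ = proj₁ (proj₂ (proj₂ (proj₂ (proj₂ (proj₂ (h∈T e∈))))))

    magic : All (λ ab → proj₁ ab + label ab + proj₂ ab ≡ σ) (h e)
    magic = proj₂ (proj₂ (proj₂ (proj₂ (proj₂ (proj₂ (h∈T e∈))))))

  ∈V⁺ : ∀ {t a} → t < n → a ∈ Vs → (suc t , a) ∈ V
  ∈V⁺ t<n a∈ = ∈-concatMap⁺ _ (lose (∈-applyUpTo⁺ suc t<n) (∈-map⁺ _ a∈))

  ∈E⁺ : ∀ {e ab} → e ∈ As → ab ∈ h e → liftArc e ab ∈ E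
  ∈E⁺ {e} e∈ ab∈ = ∈-concatMap⁺ (λ e → map (liftArc e) (h e)) (lose e∈ (∈-map⁺ (liftArc e) ab∈))

  ∈E⁻ : ∀ {x} → x ∈ E → ∃₂ λ e ab → e ∈ As × ab ∈ h e × x ≡ liftArc e ab
  ∈E⁻ x∈ with find (∈-concatMap⁻ (λ e → map (liftArc e) (h e)) x∈)
  ... | e , e∈ , x∈map with ∈-map⁻ (liftArc e) x∈map
  ... | ab , ab∈ , x≡ = e , ab , e∈ , ab∈ , x≡

  |V|≡n*p : length V ≡ n * p
  |V|≡n*p = trans (length-concatMap-const _ [1, n ] (λ _ → trans (length-map _ Vs) |Vs|≡p))
                  (cong (_* p) (length-applyUpTo suc n))

  |E|≡n*q : length E ≡ n * q
  |E|≡n*q = trans (length-concatMap-const _ As (λ {e} e∈ → trans (length-map (liftArc e) (h e)) (OnArc.|h|≡q e∈)))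
                  (cong (_* q) |As|≡n)

  |V|+|E|≡n*N : length V + length E ≡ n * N
  |V|+|E|≡n*N = trans (cong₂ _+_ |V|≡n*p |E|≡n*q) (sym (*-distribˡ-+ n p q))

  |labels|≡|V|+|E| : length labels ≡ length V + length E
  |labels|≡|V|+|E| = trans (length-++ (map f V)) (cong₂ _+_ (length-map f V) (length-map g E))

  arc-magic : ∀ {e ab} → e ∈ As → ab ∈ h e →
    f (proj₁ (liftArc e ab)) + g (liftArc e ab) + f (proj₂ (liftArc e ab)) ≡ N * (k + n ∸ 3) + σ
  arc-magic {i , j} {a , b} e∈ ab∈ with All.lookup endpoints∈[1,n] e∈
  ... | i∈ , j∈ with ∈-applyUpTo⁻ suc i∈ | ∈-applyUpTo⁻ suc j∈
  ... | i' , _ , refl | j' , _ , refl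
    with ∈-applyUpTo⁻ (k +_) (Equivalence.to (arcSums _) (∈-map⁺ arcSum e∈))
  ... | u , u<n , i+j≡k+u =
    htilde-magic p q i+j≡k+u (trans (+-suc u _) (m+[n∸m]≡n u<n)) (All.lookup (OnArc.magic e∈) ab∈)

  magic : All (λ x → f (proj₁ x) + g x + f (proj₂ x) ≡ N * (k + n ∸ 3) + σ) E
  magic = All.tabulate λ x∈ → case ∈E⁻ x∈ of λ where
    (e , ab , e∈ , ab∈ , refl) → arc-magic e∈ ab∈

  layer⊆labels : ∀ {t c} → t < n → c ∈ [1, N ] → N * t + c ∈ labels
  layer⊆labels {t} {c} t<n c∈
    with ∈-map⁻ arcSum (Equivalence.from (arcSums _) (∈-applyUpTo⁺ (k +_) (∸-monoʳ-< z<s t<n)))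
  ... | e , e∈ , sum≡ with ∈-++⁻ (map (λ a → a) Vs) (∈-resp-↭ (↭-sym (OnArc.labels↭ e∈)) c∈[1,|F|])
    where
    c∈[1,|F|] : c ∈ [1, length Vs + length (h e) ]
    c∈[1,|F|] = subst (λ m → c ∈ [1, m ]) (sym (cong₂ _+_ |Vs|≡p (OnArc.|h|≡q e∈))) c∈
  ... | inj₁ c∈Vs with ∈-map⁻ (λ a → a) c∈Vs
  ...   | c , c∈Vs′ , refl = ∈-++⁺ˡ (∈-map⁺ f (∈V⁺ t<n c∈Vs′))
  layer⊆labels {t} t<n _ | e , e∈ , sum≡ | inj₂ c∈F with ∈-map⁻ (OnArc.label e∈) c∈F
  ...   | ab , ab∈ , refl = ∈-++⁺ʳ (map f V) (subst (_∈ map g E) arcLabel≡ (∈-map⁺ g (∈E⁺ e∈ ab∈)))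
    where
    arcLabel≡ : g (liftArc e ab) ≡ N * t + OnArc.label e∈ ab
    arcLabel≡ = htildeA-layer p q {i = proj₁ e} {proj₂ e} {proj₁ ab} {proj₂ ab}
                  (sym sum≡) (m∸n+n≡m t<n) (All.lookup (OnArc.magic e∈) ab∈)

  [1,|V|+|E|]⊆labels : [1, length V + length E ] ⊆ labels
  [1,|V|+|E|]⊆labels x∈ with ∈-applyUpTo⁻ suc x∈
  ... | i , i<|V|+|E| , refl with <*⇒quotRem i n N (subst (i <_) |V|+|E|≡n*N i<|V|+|E|)
  ... | t , r , t<n , r<N , refl = subst (_∈ labels) (+-suc (N * t) r) (layer⊆labels t<n (∈-applyUpTo⁺ suc r<N))

  labels↭ : labels ↭ [1, length V + length E ]
  labels↭ = ⊆-length≤⇒↭ (Unique-[1,] _) [1,|V|+|E|]⊆labels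
              (≤-reflexive (trans |labels|≡|V|+|E| (sym (length-applyUpTo suc _))))

  Unique-labels : Unique labels
  Unique-labels = Permutationₛ.Unique-resp-↭ (setoid ℕ) (↭⇒↭ₛ (↭-sym labels↭)) (Unique-[1,] _)

  Unique-V : Unique V
  Unique-V = Unique.map⁻ (proj₁ (Unique-++⁻ (map f V) Unique-labels))

  Unique-E : Unique E
  Unique-E = Unique.map⁻ (proj₂ (Unique-++⁻ (map f V) Unique-labels))

lemma3p2 : (n k p q σ : ℕ) (Vs : List ℕ) (As : List (ℕ × ℕ))
    (h : ℕ × ℕ → List (ℕ × ℕ)) →
    Unique Vs → length Vs ≡ p → All (0 <_) Vs →
    InS n k As →
    (∀ {e} → e ∈ As → InT Vs q σ (h e)) →
    IsEdgeMagic (prodVertices n Vs) (prodArcs As h) (htildeV p q) (htildeA p q n k σ)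
      ((p + q) * (k + n ∸ 3) + σ)
lemma3p2 n k p q σ Vs As h _ |Vs|≡p _ D∈S h∈T =
  Unique-V , Unique-E , labels↭ , magic
  where open ProductLabeling n k p q σ Vs As h |Vs|≡p D∈S h∈T
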